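{- There is no finite simple graph $G$ (on a vertex set containing $\{1,2,3\}$) whose collection of cut sets is $\mathcal C(G)=\{\emptyset,\{1,2\},\{1,3\},\{2,3\}\}$.
   Context: For a graph $G$ and a set $S$ of vertices, $c_G(S)$ is the number of connected components of the induced subgraph $G-S$ on the remaining vertices. $S$ is a cut set of $G$ if $c_G(S)>c_G(S\setminus\{i\})$ for every $i\in S$ (so $\emptyset$ is always a cut set), and $\mathcal C(G)$ is the set of all cut sets of $G$. -}

module Defs where

open import Data.Nat using (ℕ; _<_)
open import Data.Fin using (Fin)
open import Data.Fin.Subset using (Subset; _∈_; _∉_; _-_)
open import Data.Product using (Σ; ∃; _×_)
open import Relation.Binary.PropositionalEquality using (_≡_)
open import Relation.Nullary using (¬_; Dec)
open import Function.Bundles using (_⇔_)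

record Graph (n : ℕ) : Set₁ where
  field
    Adj     : Fin n → Fin n → Set
    adj?    : (u v : Fin n) → Dec (Adj u v)
    sym     : ∀ {u v} → Adj u v → Adj v u
    irrefl  : ∀ {u} → ¬ Adj u u
open Graph public

data Reach {n : ℕ} (G : Graph n) (S : Subset n) : Fin n → Fin n → Set where
  here : ∀ {u} → u ∉ S → Reach G S u u
  step : ∀ {u w v} → u ∉ S → Adj G u w → Reach G S w v → Reach G S u v

-- ComponentCount G S k : the induced subgraph G - S has exactly k connected
-- components, i.e. there is a surjective labelling of the vertices outside S
-- by Fin k identifying exactly the vertices lying in the same component.
ComponentCount : {n : ℕ} → Graph n → Subset n → ℕ → Set
ComponentCount {n} G S k =
  Σ ((u : Fin n) → u ∉ S → Fin k) λ f →
    (∀ u v (pu : u ∉ S) (pv : v ∉ S) → (f u pu ≡ f v pv) ⇔ Reach G S u v)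
    × (∀ (j : Fin k) → Σ (Fin n) λ u → Σ (u ∉ S) λ pu → f u pu ≡ j)

CutSet : {n : ℕ} → Graph n → Subset n → Set
CutSet G S = ∀ i → i ∈ S → ∀ k k′ →
  ComponentCount G S k → ComponentCount G (S - i) k′ → k′ < k

{-# OPTIONS --safe #-}

-- Call i ∈ S splitting if two neighbours of i outside S lie in different components
-- of G - S. Sending each component of G - S to the component of G - (S - i) that
-- contains it shows that S is a cut set exactly when all its vertices split it (one
-- direction only up to double negation, as component counts exist only classically).
-- If the cut sets were ∅, {a,b}, {a,c}, {b,c}, then a would split {a,b} and {a,c} but
-- not {a}. Were a not splitting {a,b,c}, it would have a neighbour q separated from c
-- in G - {a,b} and a neighbour q′ separated from b in G - {a,c}, with q and q′ joined
-- in G - {a,b,c}; a walk from q′ to b in G - a meets {b,c} first at b or at c,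
-- contradicting one of the two separations, so a would split {a}. Hence a, and
-- likewise b and c, split {a,b,c}, which would therefore be a cut set.

module Submission where

open import Defs
open import Data.Nat using (ℕ; zero; suc; _≤_; _<_)
open import Data.Nat.Properties using (<⇒≱)
open import Data.Fin using (Fin; zero; suc; _≟_)
open import Data.Fin.Properties using (suc-injective; injective⇒≤)
open import Data.Fin.Subset using (Subset; ⊥; ⁅_⁆; _∪_; _∈_; _∉_; _⊆_; _-_)
open import Data.Fin.Subset.Properties
  using (∉⊥; x∈⁅x⁆; x∈⁅y⁆⇒x≡y; x≢y⇒x∉⁅y⁆; _∈?_; x∈p∪q⁻; p⊆p∪q; q⊆p∪q; p─q⊆p; x∈p∧x≢y⇒x∈p-y; ∪-assoc; ∪-comm; ∪-commutativeMonoid)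
open import Data.Vec.Base using (_∷_; there)
open import Data.Sum using (_⊎_; inj₁; inj₂; [_,_])
open import Data.Product using (Σ; Σ-syntax; ∃; _×_; _,_; proj₁; proj₂)
open import Data.Empty using (⊥-elim)
open import Function using (_∘_; case_of_)
open import Function.Bundles using (_⇔_; mk⇔; Equivalence)
open import Relation.Binary.PropositionalEquality
  using (_≡_; _≢_; refl; trans; cong; subst; module ≡-Reasoning) renaming (sym to ≡-sym)
open import Relation.Nullary using (¬_; yes; no)
open import Relation.Nullary.Decidable using (decidable-stable; ¬¬-excluded-middle)
open import Relation.Nullary.Negation using (DoubleNegation; ¬¬-Monad)
open import Effect.Monad using (RawMonad)
open import Level using (0ℓ)
open import Algebra.Bundles using (CommutativeMonoid)
import Algebra.Properties.CommutativeSemigroup as CommutativeSemigroupProperties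

open Equivalence using (to; from)
open RawMonad (¬¬-Monad {a = 0ℓ}) using (pure; _>>=_)
open module ∪-Properties {n} =
  CommutativeSemigroupProperties (CommutativeMonoid.commutativeSemigroup (∪-commutativeMonoid n))
  using (xy∙z≈x∙zy; x∙yz≈y∙xz; x∙yz≈y∙zx)

private variable
  n k k′ : ℕ
  A S S′ : Subset n
  i u v w x y z b c : Fin n

x∉p-x : {p : Subset n} → x ∉ p - x
x∉p-x {x = zero}  {_ ∷ _} ()
x∉p-x {x = suc x} {_ ∷ _} (there m) = x∉p-x m

x∉p-y⇒x∉p : {p : Subset n} → x ∉ p - y → x ≢ y → x ∉ p
x∉p-y⇒x∉p x∉p-y x≢y x∈p = x∉p-y (x∈p∧x≢y⇒x∈p-y x∈p x≢y)

x∈p∪⁅y⁆∪⁅z⁆⁻ : (p : Subset n) → x ∈ p ∪ ⁅ y ⁆ ∪ ⁅ z ⁆ → x ∈ p ⊎ x ≡ y ⊎ x ≡ z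
x∈p∪⁅y⁆∪⁅z⁆⁻ {y = y} {z} p x∈ with x∈p∪q⁻ p _ x∈
... | inj₁ x∈p = inj₁ x∈p
... | inj₂ x∈yz with x∈p∪q⁻ ⁅ y ⁆ ⁅ z ⁆ x∈yz
...   | inj₁ x∈y = inj₂ (inj₁ (x∈⁅y⁆⇒x≡y y x∈y))
...   | inj₂ x∈z = inj₂ (inj₂ (x∈⁅y⁆⇒x≡y z x∈z))

x∉p∪⁅y⁆ : {p : Subset n} → x ∉ p → x ≢ y → x ∉ p ∪ ⁅ y ⁆
x∉p∪⁅y⁆ {p = p} x∉p x≢y x∈ = [ x∉p , x≢y⇒x∉⁅y⁆ x≢y ] (x∈p∪q⁻ p _ x∈)

surjective∧collision⇒< : {x₁ x₂ : Fin k} (h : Fin k → Fin k′) → (∀ y → ∃ λ x → h x ≡ y) →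
                         x₁ ≢ x₂ → h x₁ ≡ h x₂ → k′ < k
surjective∧collision⇒< {k = k} {k′} {x₁} {x₂} h onto x₁≢x₂ collision = injective⇒≤ ι-injective
  where
  s : Fin k′ → Fin k
  s y with y ≟ h x₁
  ... | yes _ = x₁
  ... | no _  = proj₁ (onto y)

  h∘s : ∀ y → h (s y) ≡ y
  h∘s y with y ≟ h x₁
  ... | yes y≡hx₁ = ≡-sym y≡hx₁
  ... | no _      = proj₂ (onto y)

  x₂∉image : ∀ y → s y ≢ x₂
  x₂∉image y with y ≟ h x₁
  ... | yes _    = x₁≢x₂
  ... | no y≢hx₁ = λ e → y≢hx₁ (trans (≡-sym (proj₂ (onto y))) (trans (cong h e) (≡-sym collision)))

  ι : Fin (suc k′) → Fin k
  ι zero    = x₂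
  ι (suc y) = s y

  ι-injective : ∀ {a b} → ι a ≡ ι b → a ≡ b
  ι-injective {zero}  {zero}   _ = refl
  ι-injective {zero}  {suc b}  e = ⊥-elim (x₂∉image b (≡-sym e))
  ι-injective {suc a} {zero}   e = ⊥-elim (x₂∉image a e)
  ι-injective {suc a} {suc b}  e = cong suc (trans (≡-sym (h∘s a)) (trans (cong h e) (h∘s b)))

-- ComponentCount G S k is Classification (_∉ S) (Reach G S) k.
Classification : (P : Fin n → Set) (R : Fin n → Fin n → Set) → ℕ → Set
Classification {n} P R k =
  Σ ((u : Fin n) → P u → Fin k) λ f →
    (∀ u v (pu : P u) (pv : P v) → (f u pu ≡ f v pv) ⇔ R u v)
    × (∀ (j : Fin k) → Σ (Fin n) λ u → Σ (P u) λ pu → f u pu ≡ j)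

module ExtendClassification
  {P : Fin (suc n) → Set} {R : Fin (suc n) → Fin (suc n) → Set}
  (R-refl : ∀ {u} → P u → R u u)
  (R-sym : ∀ {u v} → R u v → R v u)
  (R-trans : ∀ {u v w} → R u v → R v w → R u w)
  where

  Rˢ : Fin n → Fin n → Set
  Rˢ u v = R (suc u) (suc v)

  zero-absent : ¬ P zero → Classification (P ∘ suc) Rˢ k → Classification P R k
  zero-absent ¬p₀ (g , g-⇔ , g-onto) = f , f-⇔ , f-onto
    where
    f : ∀ u → P u → Fin _
    f zero    p₀ = ⊥-elim (¬p₀ p₀)
    f (suc u) pu = g u pu
    f-⇔ : ∀ u v pu pv → (f u pu ≡ f v pv) ⇔ R u v
    f-⇔ zero    _       p₀ _  = ⊥-elim (¬p₀ p₀)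
    f-⇔ (suc u) zero    _  p₀ = ⊥-elim (¬p₀ p₀)
    f-⇔ (suc u) (suc v) pu pv = g-⇔ u v pu pv
    f-onto : ∀ j → Σ _ λ u → Σ (P u) λ pu → f u pu ≡ j
    f-onto j = let u , pu , e = g-onto j in suc u , pu , e

  zero-joins : ∀ v₀ → P (suc v₀) → R zero (suc v₀) →
               Classification (P ∘ suc) Rˢ k → Classification P R k
  zero-joins v₀ pv₀ r₀ (g , g-⇔ , g-onto) = f , f-⇔ , f-onto
    where
    f : ∀ u → P u → Fin _
    f zero    _  = g v₀ pv₀
    f (suc u) pu = g u pu
    f-⇔ : ∀ u v pu pv → (f u pu ≡ f v pv) ⇔ R u v
    f-⇔ zero    zero    p₀ _  = mk⇔ (λ _ → R-refl p₀) (λ _ → refl)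
    f-⇔ zero    (suc v) _  pv = mk⇔ (R-trans r₀ ∘ to (g-⇔ v₀ v pv₀ pv))
                                    (from (g-⇔ v₀ v pv₀ pv) ∘ R-trans (R-sym r₀))
    f-⇔ (suc u) zero    pu _  = mk⇔ (λ e → R-trans (to (g-⇔ u v₀ pu pv₀) e) (R-sym r₀))
                                    (λ r → from (g-⇔ u v₀ pu pv₀) (R-trans r r₀))
    f-⇔ (suc u) (suc v) pu pv = g-⇔ u v pu pv
    f-onto : ∀ j → Σ _ λ u → Σ (P u) λ pu → f u pu ≡ j
    f-onto j = let u , pu , e = g-onto j in suc u , pu , e

  zero-alone : P zero → ¬ (Σ[ v ∈ Fin n ] P (suc v) × R zero (suc v)) →
               Classification (P ∘ suc) Rˢ k → Classification P R (suc k)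
  zero-alone p₀ isolated (g , g-⇔ , g-onto) = f , f-⇔ , f-onto
    where
    f : ∀ u → P u → Fin _
    f zero    _  = zero
    f (suc u) pu = suc (g u pu)
    f-⇔ : ∀ u v pu pv → (f u pu ≡ f v pv) ⇔ R u v
    f-⇔ zero    zero    p₀ _  = mk⇔ (λ _ → R-refl p₀) (λ _ → refl)
    f-⇔ zero    (suc v) _  pv = mk⇔ (λ ()) (λ r → ⊥-elim (isolated (v , pv , r)))
    f-⇔ (suc u) zero    pu _  = mk⇔ (λ ()) (λ r → ⊥-elim (isolated (u , pu , R-sym r)))
    f-⇔ (suc u) (suc v) pu pv = mk⇔ (to (g-⇔ u v pu pv) ∘ suc-injective)
                                    (cong suc ∘ from (g-⇔ u v pu pv))
    f-onto : ∀ j → Σ _ λ u → Σ (P u) λ pu → f u pu ≡ j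
    f-onto zero    = zero , p₀ , refl
    f-onto (suc j) = let u , pu , e = g-onto j in suc u , pu , cong suc e

-- R is not assumed decidable, so the number of classes exists only under double negation.
¬¬-classification : (P : Fin n → Set) (R : Fin n → Fin n → Set) →
  (∀ {u} → P u → R u u) → (∀ {u v} → R u v → R v u) → (∀ {u v w} → R u v → R v w → R u w) →
  DoubleNegation (∃ (Classification P R))
¬¬-classification {zero}  P R _      _     _       = pure (0 , (λ ()) , (λ ()) , λ ())
¬¬-classification {suc n} P R R-refl R-sym R-trans = do
  k , c ← ¬¬-classification (P ∘ suc) Rˢ R-refl R-sym R-trans
  ¬¬-excluded-middle {A = P zero} >>= λ where
    (no ¬p₀) → pure (k , zero-absent ¬p₀ c)
    (yes p₀) → ¬¬-excluded-middle {A = Σ[ v ∈ Fin n ] P (suc v) × R zero (suc v)} >>= λ where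
      (yes (v , pv , r)) → pure (k , zero-joins v pv r c)
      (no isolated)      → pure (suc k , zero-alone p₀ isolated c)
  where open ExtendClassification R-refl R-sym R-trans

module _ (G : Graph n) where

  Reach-start : Reach G S u v → u ∉ S
  Reach-start (here u∉S)     = u∉S
  Reach-start (step u∉S _ _) = u∉S

  Reach-end : Reach G S u v → v ∉ S
  Reach-end (here v∉S)   = v∉S
  Reach-end (step _ _ r) = Reach-end r

  Reach-trans : Reach G S u v → Reach G S v w → Reach G S u w
  Reach-trans (here _)        r′ = r′
  Reach-trans (step u∉S uw r) r′ = step u∉S uw (Reach-trans r r′)

  Reach-snoc : Reach G S u v → Adj G v w → w ∉ S → Reach G S u w
  Reach-snoc r vw w∉S = Reach-trans r (step (Reach-end r) vw (here w∉S))

  Reach-sym : Reach G S u v → Reach G S v u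
  Reach-sym (here u∉S)      = here u∉S
  Reach-sym (step u∉S uw r) = Reach-snoc (Reach-sym r) (sym G uw) u∉S

  Reach-⊆ : S ⊆ S′ → Reach G S′ u v → Reach G S u v
  Reach-⊆ S⊆S′ (here u∉S′)       = here (u∉S′ ∘ S⊆S′)
  Reach-⊆ S⊆S′ (step u∉S′ uw r) = step (u∉S′ ∘ S⊆S′) uw (Reach-⊆ S⊆S′ r)

  Splits : Subset n → Fin n → Set
  Splits S i = Σ[ u ∈ Fin n ] Σ[ v ∈ Fin n ]
    u ∉ S × v ∉ S × Adj G i u × Adj G i v × ¬ Reach G S u v

  componentCount : (S : Subset n) → DoubleNegation (∃ (ComponentCount G S))
  componentCount S = ¬¬-classification (_∉ S) (Reach G S) here Reach-sym Reach-trans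

  ¬splits⇒¬¬reach : i ∈ S → ¬ Splits S i →
                    Reach G (S - i) u v → u ∉ S → v ∉ S → DoubleNegation (Reach G S u v)
  ¬splits⇒¬¬reach i∈S ¬split (here _) u∉S _ = pure (here u∉S)
  ¬splits⇒¬¬reach {i = i} i∈S ¬split (step {w = w} _ uw r) u∉S v∉S with w ≟ i
  ... | no w≢i = do
    r′ ← ¬splits⇒¬¬reach i∈S ¬split r (x∉p-y⇒x∉p (Reach-start r) w≢i) v∉S
    pure (step u∉S uw r′)
  ... | yes refl with r
  ...   | here _ = ⊥-elim (v∉S i∈S)
  -- the walk passes through i between two neighbours of i, which are ¬¬-joined outside S
  ...   | step {w = w′} _ iw′ r′ = do
    let w′∉S = x∉p-y⇒x∉p (Reach-start r′) λ { refl → irrefl G iw′ }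
    r₁ ← λ ¬r₁ → ¬split (_ , w′ , u∉S , w′∉S , sym G uw , iw′ , ¬r₁)
    r₂ ← ¬splits⇒¬¬reach i∈S ¬split r′ w′∉S v∉S
    pure (Reach-trans r₁ r₂)

module ComponentMap (G : Graph n) {S : Subset n} {i : Fin n} (i∈S : i ∈ S)
  (cc : ComponentCount G S k) (cc′ : ComponentCount G (S - i) k′) where

  label : ∀ u → u ∉ S → Fin k
  label = proj₁ cc

  label-⇔ : ∀ u v pu pv → (label u pu ≡ label v pv) ⇔ Reach G S u v
  label-⇔ = proj₁ (proj₂ cc)

  label-onto : ∀ j → Σ (Fin n) λ u → Σ (u ∉ S) λ pu → label u pu ≡ j
  label-onto = proj₂ (proj₂ cc)

  label′ : ∀ u → u ∉ S - i → Fin k′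
  label′ = proj₁ cc′

  label′-⇔ : ∀ u v pu pv → (label′ u pu ≡ label′ v pv) ⇔ Reach G (S - i) u v
  label′-⇔ = proj₁ (proj₂ cc′)

  label′-onto : ∀ j → Σ (Fin n) λ u → Σ (u ∉ S - i) λ pu → label′ u pu ≡ j
  label′-onto = proj₂ (proj₂ cc′)

  S-i⊆S : S - i ⊆ S
  S-i⊆S = p─q⊆p S ⁅ i ⁆

  component : Fin k → Fin k′
  component j = let u , u∉S , _ = label-onto j in label′ u (u∉S ∘ S-i⊆S)

  component-label : (u∉S : u ∉ S) (u∉S-i : u ∉ S - i) → component (label u u∉S) ≡ label′ u u∉S-i
  component-label {u} u∉S u∉S-i =
    let r , r∉S , e = label-onto (label u u∉S)
    in from (label′-⇔ r u _ u∉S-i) (Reach-⊆ G S-i⊆S (to (label-⇔ r u r∉S u∉S) e))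

  splits⇒< : Splits G S i → k′ < k
  splits⇒< (u , v , u∉S , v∉S , iu , iv , ¬u~v) =
    surjective∧collision⇒< component component-onto
      (¬u~v ∘ to (label-⇔ u v u∉S v∉S)) collision
    where
    i∉S-i : i ∉ S - i
    i∉S-i = x∉p-x

    to-i : ∀ {x} → x ∉ S → Adj G i x → Reach G (S - i) x i
    to-i x∉S ix = step (x∉S ∘ S-i⊆S) (sym G ix) (here i∉S-i)

    component-onto : ∀ j′ → ∃ λ j → component j ≡ j′
    component-onto j′ with label′-onto j′
    ... | w , w∉S-i , e with w ≟ i
    ...   | no w≢i  = let w∉S = x∉p-y⇒x∉p w∉S-i w≢i in
                      label w w∉S , trans (component-label w∉S w∉S-i) e
    ...   | yes refl = let u∉S-i = u∉S ∘ S-i⊆S in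
                       label u u∉S , trans (component-label u∉S u∉S-i)
                                      (trans (from (label′-⇔ u i u∉S-i w∉S-i) (to-i u∉S iu)) e)

    collision : component (label u u∉S) ≡ component (label v v∉S)
    collision = begin
      component (label u u∉S)  ≡⟨ component-label u∉S (u∉S ∘ S-i⊆S) ⟩
      label′ u _               ≡⟨ from (label′-⇔ u v _ _) (Reach-trans G (to-i u∉S iu) (Reach-sym G (to-i v∉S iv))) ⟩
      label′ v _               ≡⟨ component-label v∉S (v∉S ∘ S-i⊆S) ⟨
      component (label v v∉S)  ∎
      where open ≡-Reasoning

  ¬splits⇒≤ : ¬ Splits G S i → k ≤ k′
  ¬splits⇒≤ ¬split = injective⇒≤ component-injective
    where
    component-injective : ∀ {j₁ j₂} → component j₁ ≡ component j₂ → j₁ ≡ j₂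
    component-injective {j₁} {j₂} e = decidable-stable (j₁ ≟ j₂) do
      let u₁ , u₁∉S , e₁ = label-onto j₁
          u₂ , u₂∉S , e₂ = label-onto j₂
      r ← ¬splits⇒¬¬reach G i∈S ¬split (to (label′-⇔ u₁ u₂ _ _) e) u₁∉S u₂∉S
      pure (trans (≡-sym e₁) (trans (from (label-⇔ u₁ u₂ u₁∉S u₂∉S) r) e₂))

module _ (G : Graph n) where

  splits⇒cutSet : (∀ i → i ∈ S → Splits G S i) → CutSet G S
  splits⇒cutSet split i i∈S k k′ cc cc′ = ComponentMap.splits⇒< G i∈S cc cc′ (split i i∈S)

  splits⇒cutSet-⁅⁆ : Splits G ⁅ x ⁆ x → CutSet G ⁅ x ⁆
  splits⇒cutSet-⁅⁆ {x = x} split = splits⇒cutSet λ i i∈⁅x⁆ →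
    subst (Splits G ⁅ x ⁆) (≡-sym (x∈⁅y⁆⇒x≡y x i∈⁅x⁆)) split

  cutSet⇒¬¬splits : CutSet G S → i ∈ S → DoubleNegation (Splits G S i)
  cutSet⇒¬¬splits {S = S} {i = i} cut i∈S ¬split =
    componentCount G S λ (k , cc) →
    componentCount G (S - i) λ (k′ , cc′) →
    <⇒≱ (cut i i∈S k k′ cc cc′) (ComponentMap.¬splits⇒≤ G i∈S cc cc′ ¬split)

  splits-∪⁅⁆ : ∀ z → Splits G S i →
    Splits G (S ∪ ⁅ z ⁆) i ⊎ Σ[ q ∈ Fin n ] q ∉ S ∪ ⁅ z ⁆ × Adj G i q × Adj G i z × ¬ Reach G S z q
  splits-∪⁅⁆ z (u , v , u∉S , v∉S , iu , iv , ¬u~v) with u ≟ z | v ≟ z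
  ... | yes refl | yes refl = ⊥-elim (¬u~v (here u∉S))
  ... | yes refl | no v≢z   = inj₂ (v , x∉p∪⁅y⁆ v∉S v≢z , iv , iu , ¬u~v)
  ... | no u≢z   | yes refl = inj₂ (u , x∉p∪⁅y⁆ u∉S u≢z , iu , iv , ¬u~v ∘ Reach-sym G)
  ... | no u≢z   | no v≢z   =
    inj₁ (u , v , x∉p∪⁅y⁆ u∉S u≢z , x∉p∪⁅y⁆ v∉S v≢z , iu , iv , ¬u~v ∘ Reach-⊆ G (p⊆p∪q ⁅ z ⁆))

  Reach-first-entry : Reach G A u v → u ∉ S → v ∈ S →
    Σ[ w ∈ Fin n ] Σ[ y ∈ Fin n ] Reach G S u w × Adj G w y × y ∈ S × y ∉ A
  Reach-first-entry (here _) u∉S u∈S = ⊥-elim (u∉S u∈S)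
  Reach-first-entry {S = S} (step {w = w} _ uw r) u∉S v∈S with w ∈? S
  ... | yes w∈S = _ , w , here u∉S , uw , w∈S , Reach-start G r
  ... | no w∉S  = let w′ , y , r′ , w′y , y∈S , y∉A = Reach-first-entry r w∉S v∈S
                  in w′ , y , step u∉S uw r′ , w′y , y∈S , y∉A

  splits-∪⁅⁆∪⁅⁆ : b ∉ A → c ∉ A → b ≢ c →
    Splits G (A ∪ ⁅ b ⁆) i → Splits G (A ∪ ⁅ c ⁆) i → ¬ Splits G A i →
    DoubleNegation (Splits G (A ∪ ⁅ b ⁆ ∪ ⁅ c ⁆) i)
  splits-∪⁅⁆∪⁅⁆ {b = b} {A = A} {c = c} {i = i} b∉A c∉A b≢c split-b split-c ¬split-A
    with splits-∪⁅⁆ c split-b | splits-∪⁅⁆ b split-c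
  ... | inj₁ split | _          = pure (subst (λ T → Splits G T i) (∪-assoc A ⁅ b ⁆ ⁅ c ⁆) split)
  ... | inj₂ _     | inj₁ split = pure (subst (λ T → Splits G T i) (xy∙z≈x∙zy A ⁅ c ⁆ ⁅ b ⁆) split)
  ... | inj₂ (q , q∉X∪c , iq , ic , ¬c~q) | inj₂ (q′ , q′∉Y∪b , iq′ , ib , ¬b~q′) =
    ¬¬-excluded-middle >>= λ where
      (no ¬q~q′) → pure (q , q′ , q∉T , q′∉T , iq , iq′ , ¬q~q′)
      (yes q~q′) → ⊥-elim (¬split-A (q′ , b , q′∉A , b∉A , iq′ , ib , ¬q′~b q~q′))
    where
    T X Y : Subset _
    T = A ∪ ⁅ b ⁆ ∪ ⁅ c ⁆
    X = A ∪ ⁅ b ⁆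
    Y = A ∪ ⁅ c ⁆

    X⊆T : X ⊆ T
    X⊆T = subst (X ⊆_) (∪-assoc A ⁅ b ⁆ ⁅ c ⁆) (p⊆p∪q ⁅ c ⁆)

    Y⊆T : Y ⊆ T
    Y⊆T = subst (Y ⊆_) (xy∙z≈x∙zy A ⁅ c ⁆ ⁅ b ⁆) (p⊆p∪q ⁅ b ⁆)

    q∉T : q ∉ T
    q∉T = subst (q ∉_) (∪-assoc A ⁅ b ⁆ ⁅ c ⁆) q∉X∪c

    q′∉T : q′ ∉ T
    q′∉T = subst (q′ ∉_) (xy∙z≈x∙zy A ⁅ c ⁆ ⁅ b ⁆) q′∉Y∪b

    q′∉A : q′ ∉ A
    q′∉A = q′∉T ∘ Y⊆T ∘ p⊆p∪q ⁅ c ⁆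

    ¬q′~b : Reach G T q q′ → ¬ Reach G A q′ b
    ¬q′~b q~q′ q′~b with Reach-first-entry q′~b q′∉T (q⊆p∪q A _ (p⊆p∪q ⁅ c ⁆ (x∈⁅x⁆ b)))
    ... | w , y , q′~w , wy , y∈T , y∉A with x∈p∪⁅y⁆∪⁅z⁆⁻ A y∈T
    ...   | inj₁ y∈A         = y∉A y∈A
    ...   | inj₂ (inj₁ refl) =
      ¬b~q′ (Reach-sym G (Reach-snoc G (Reach-⊆ G Y⊆T q′~w) wy (x∉p∪⁅y⁆ b∉A b≢c)))
    ...   | inj₂ (inj₂ refl) =
      ¬c~q (Reach-sym G (Reach-snoc G (Reach-⊆ G X⊆T (Reach-trans G q~q′ q′~w)) wy
                                      (x∉p∪⁅y⁆ c∉A (b≢c ∘ ≡-sym))))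

  ¬¬splits-⁅x⁆∪⁅y⁆∪⁅z⁆ : x ≢ y → x ≢ z → y ≢ z →
    CutSet G (⁅ x ⁆ ∪ ⁅ y ⁆) → CutSet G (⁅ x ⁆ ∪ ⁅ z ⁆) → ¬ CutSet G ⁅ x ⁆ →
    DoubleNegation (Splits G (⁅ x ⁆ ∪ ⁅ y ⁆ ∪ ⁅ z ⁆) x)
  ¬¬splits-⁅x⁆∪⁅y⁆∪⁅z⁆ {x = x} x≢y x≢z y≢z cut-xy cut-xz ¬cut-x = do
    split-xy ← cutSet⇒¬¬splits cut-xy (p⊆p∪q _ (x∈⁅x⁆ x))
    split-xz ← cutSet⇒¬¬splits cut-xz (p⊆p∪q _ (x∈⁅x⁆ x))
    splits-∪⁅⁆∪⁅⁆ (x≢y⇒x∉⁅y⁆ (x≢y ∘ ≡-sym)) (x≢y⇒x∉⁅y⁆ (x≢z ∘ ≡-sym)) y≢z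
                  split-xy split-xz (¬cut-x ∘ splits⇒cutSet-⁅⁆)

  ¬¬all-split-⁅x⁆∪⁅y⁆∪⁅z⁆ : x ≢ y → x ≢ z → y ≢ z →
    CutSet G (⁅ x ⁆ ∪ ⁅ y ⁆) → CutSet G (⁅ x ⁆ ∪ ⁅ z ⁆) → CutSet G (⁅ y ⁆ ∪ ⁅ z ⁆) →
    ¬ CutSet G ⁅ x ⁆ → ¬ CutSet G ⁅ y ⁆ → ¬ CutSet G ⁅ z ⁆ →
    DoubleNegation (∀ i → i ∈ ⁅ x ⁆ ∪ ⁅ y ⁆ ∪ ⁅ z ⁆ → Splits G (⁅ x ⁆ ∪ ⁅ y ⁆ ∪ ⁅ z ⁆) i)
  ¬¬all-split-⁅x⁆∪⁅y⁆∪⁅z⁆ {x = x} {y = y} {z = z} x≢y x≢z y≢z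
                          cut-xy cut-xz cut-yz ¬cut-x ¬cut-y ¬cut-z = do
    split-x ← ¬¬splits-⁅x⁆∪⁅y⁆∪⁅z⁆ x≢y x≢z y≢z cut-xy cut-xz ¬cut-x
    split-y ← ¬¬splits-⁅x⁆∪⁅y⁆∪⁅z⁆ (x≢y ∘ ≡-sym) y≢z x≢z
                (subst (CutSet G) (∪-comm ⁅ x ⁆ ⁅ y ⁆) cut-xy) cut-yz ¬cut-y
    split-z ← ¬¬splits-⁅x⁆∪⁅y⁆∪⁅z⁆ (x≢z ∘ ≡-sym) (y≢z ∘ ≡-sym) x≢y
                (subst (CutSet G) (∪-comm ⁅ x ⁆ ⁅ z ⁆) cut-xz)
                (subst (CutSet G) (∪-comm ⁅ y ⁆ ⁅ z ⁆) cut-yz) ¬cut-z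
    pure λ i i∈T → case x∈p∪⁅y⁆∪⁅z⁆⁻ ⁅ x ⁆ i∈T of λ where
      (inj₁ i∈⁅x⁆)       → subst (Splits G _) (≡-sym (x∈⁅y⁆⇒x≡y x i∈⁅x⁆)) split-x
      (inj₂ (inj₁ refl)) → subst (λ S → Splits G S y) (x∙yz≈y∙xz ⁅ y ⁆ ⁅ x ⁆ ⁅ z ⁆) split-y
      (inj₂ (inj₂ refl)) → subst (λ S → Splits G S z) (x∙yz≈y∙zx ⁅ z ⁆ ⁅ x ⁆ ⁅ y ⁆) split-z

EmptyOrPairOf : Fin n → Fin n → Fin n → Subset n → Set
EmptyOrPairOf x y z S = S ≡ ⊥ ⊎ S ≡ ⁅ x ⁆ ∪ ⁅ y ⁆ ⊎ S ≡ ⁅ x ⁆ ∪ ⁅ z ⁆ ⊎ S ≡ ⁅ y ⁆ ∪ ⁅ z ⁆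

x∉⁅y⁆∪⁅z⁆ : x ≢ y → x ≢ z → x ∉ ⁅ y ⁆ ∪ ⁅ z ⁆
x∉⁅y⁆∪⁅z⁆ x≢y = x∉p∪⁅y⁆ (x≢y⇒x∉⁅y⁆ x≢y)

⁅x⁆≢⁅y⁆∪⁅z⁆ : y ≢ z → ⁅ x ⁆ ≢ ⁅ y ⁆ ∪ ⁅ z ⁆
⁅x⁆≢⁅y⁆∪⁅z⁆ {y = y} {z = z} {x = x} y≢z e =
  y≢z (trans (x∈⁅y⁆⇒x≡y x (subst (y ∈_) (≡-sym e) (p⊆p∪q _ (x∈⁅x⁆ y))))
             (≡-sym (x∈⁅y⁆⇒x≡y x (subst (z ∈_) (≡-sym e) (q⊆p∪q _ _ (x∈⁅x⁆ z))))))

¬EmptyOrPairOf-⁅w⁆ : x ≢ y → x ≢ z → y ≢ z → ¬ EmptyOrPairOf x y z ⁅ w ⁆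
¬EmptyOrPairOf-⁅w⁆ {w = w} _   _   _   (inj₁ e)               = ∉⊥ (subst (w ∈_) e (x∈⁅x⁆ w))
¬EmptyOrPairOf-⁅w⁆         x≢y _   _   (inj₂ (inj₁ e))        = ⁅x⁆≢⁅y⁆∪⁅z⁆ x≢y e
¬EmptyOrPairOf-⁅w⁆         _   x≢z _   (inj₂ (inj₂ (inj₁ e))) = ⁅x⁆≢⁅y⁆∪⁅z⁆ x≢z e
¬EmptyOrPairOf-⁅w⁆         _   _   y≢z (inj₂ (inj₂ (inj₂ e))) = ⁅x⁆≢⁅y⁆∪⁅z⁆ y≢z e

¬EmptyOrPairOf-⁅x⁆∪⁅y⁆∪⁅z⁆ : x ≢ y → x ≢ z → y ≢ z → ¬ EmptyOrPairOf x y z (⁅ x ⁆ ∪ ⁅ y ⁆ ∪ ⁅ z ⁆)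
¬EmptyOrPairOf-⁅x⁆∪⁅y⁆∪⁅z⁆ {x = x} {y = y} {z = z} x≢y x≢z y≢z = λ where
    (inj₁ e)               → ∉⊥ (subst (x ∈_) e x∈T)
    (inj₂ (inj₁ e))        → x∉⁅y⁆∪⁅z⁆ (x≢z ∘ ≡-sym) (y≢z ∘ ≡-sym) (subst (z ∈_) e z∈T)
    (inj₂ (inj₂ (inj₁ e))) → x∉⁅y⁆∪⁅z⁆ (x≢y ∘ ≡-sym) y≢z (subst (y ∈_) e y∈T)
    (inj₂ (inj₂ (inj₂ e))) → x∉⁅y⁆∪⁅z⁆ x≢y x≢z (subst (x ∈_) e x∈T)
  where
  T : Subset _
  T = ⁅ x ⁆ ∪ ⁅ y ⁆ ∪ ⁅ z ⁆
  x∈T : x ∈ T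
  x∈T = p⊆p∪q _ (x∈⁅x⁆ x)
  y∈T : y ∈ T
  y∈T = q⊆p∪q ⁅ x ⁆ _ (p⊆p∪q _ (x∈⁅x⁆ y))
  z∈T : z ∈ T
  z∈T = q⊆p∪q ⁅ x ⁆ _ (q⊆p∪q ⁅ y ⁆ _ (x∈⁅x⁆ z))

proposition3p11 : (n : ℕ) (G : Graph n) (a b c : Fin n) → a ≢ b → a ≢ c → b ≢ c →
    ¬ (∀ (S : Subset n) → CutSet G S ⇔
        (S ≡ ⊥ ⊎ S ≡ ⁅ a ⁆ ∪ ⁅ b ⁆ ⊎ S ≡ ⁅ a ⁆ ∪ ⁅ c ⁆ ⊎ S ≡ ⁅ b ⁆ ∪ ⁅ c ⁆))
proposition3p11 n G a b c a≢b a≢c b≢c cutSets =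
  ¬¬all-split-⁅x⁆∪⁅y⁆∪⁅z⁆ G a≢b a≢c b≢c
    (listed⇒cutSet (inj₂ (inj₁ refl))) (listed⇒cutSet (inj₂ (inj₂ (inj₁ refl))))
    (listed⇒cutSet (inj₂ (inj₂ (inj₂ refl))))
    (¬cutSet-⁅⁆ a) (¬cutSet-⁅⁆ b) (¬cutSet-⁅⁆ c)
    λ all-split → ¬EmptyOrPairOf-⁅x⁆∪⁅y⁆∪⁅z⁆ a≢b a≢c b≢c (to (cutSets _) (splits⇒cutSet G all-split))
  where
  listed⇒cutSet : ∀ {S} → EmptyOrPairOf a b c S → CutSet G S
  listed⇒cutSet = from (cutSets _)

  ¬cutSet-⁅⁆ : ∀ x → ¬ CutSet G ⁅ x ⁆
  ¬cutSet-⁅⁆ x = ¬EmptyOrPairOf-⁅w⁆ a≢b a≢c b≢c ∘ to (cutSets ⁅ x ⁆)
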